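{- Let $A$ be a set of positive integers with greatest common divisor $r$. If $A$ satisfies the weak addition property, then $A$ is a cofinite subset of $r\mathbb{Z}^+$ (i.e., $r\mathbb{Z}^+\setminus A$ is finite).
   Context: A positive combination of a set $\{b_1,\dots,b_k\}$ of integers is an integer $m_1b_1+\dots+m_kb_k$ with all $m_i$ positive integers. A set $A$ of positive integers satisfies the weak addition property if there exist a finite subset $B=\{b_1,\dots,b_k\}\subseteq A$ with $\gcd(B)=\gcd(A)$ and a multiple $l$ of $\gcd(A)$ such that $l+c\in A$ for every positive combination $c$ of elements of $B$. -}

module Defs where

open import Data.Nat using (ℕ; zero; suc; _+_; _*_; _<_; _≤_)
open import Data.Nat.Divisibility using (_∣_)
open import Data.Nat.GCD using (gcd)
open import Data.Integer as ℤ using (ℤ; +_)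
import Data.Integer.Divisibility as ℤD
open import Data.List using (List; []; _∷_; foldr)
open import Data.List.Relation.Unary.All using (All)
open import Data.List.Relation.Unary.Unique.Propositional using (Unique)
open import Data.List.Membership.Propositional using (_∈_)
open import Data.Product using (Σ; ∃; ∃-syntax; _×_)
open import Relation.Nullary using (¬_)
open import Relation.Binary.PropositionalEquality using (_≡_)

Pred : Set₁
Pred = ℕ → Set

IsGcdOf : Pred → ℕ → Set
IsGcdOf A r = (∀ a → A a → r ∣ a) × (∀ d → (∀ a → A a → d ∣ a) → d ∣ r)

gcdList : List ℕ → ℕ
gcdList = foldr gcd 0

data PosComb : List ℕ → ℕ → Set where
  []  : PosComb [] 0
  _∷_ : ∀ {b bs c} m → 1 ≤ m → PosComb bs c → PosComb (b ∷ bs) (m * b + c)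

WeakAddition : Pred → ℕ → Set
WeakAddition A r =
  Σ (List ℕ) λ B →
    Unique B × All A B × gcdList B ≡ r ×
    Σ ℤ λ l → (+ r) ℤD.∣ l ×
      (∀ c → PosComb B c → Σ ℕ λ n → (+ n ≡ l ℤ.+ + c) × A n)

CofiniteIn-rZ+ : Pred → ℕ → Set
CofiniteIn-rZ+ A r =
  (∀ a → A a → (0 < a × r ∣ a)) ×
  Σ (List ℕ) λ L → ∀ m → 0 < m → r ∣ m → ¬ A m → m ∈ L

{-# OPTIONS --safe #-}
module Submission where

-- Bézout's identity for the finite generating set B gives an element x of the
-- monoid of non-negative combinations of B with x + r also in it, where
-- r = gcd B; being a multiple of r, x = w r.  Two consecutive multiples w r and
-- (w + 1) r of r generate every t r with t ≥ w², and adding one copy of each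
-- generator turns non-negative combinations into positive ones.  So every
-- large multiple c of r is a positive combination of B, hence l + c ∈ A; since
-- r ∣ l, this covers every large multiple of r.

open import Defs
open import Data.Nat using (ℕ; zero; suc; _+_; _*_; _∸_; _≤_; _<_; _<?_; NonZero; z≤n; s≤s; z<s; >-nonZero; s≤s⁻¹)
open import Data.Nat.Properties
open import Data.Nat.Divisibility using (_∣_; divides; ∣-trans; ∣m∣n⇒∣m+n; ∣m+n∣m⇒∣n; n∣m*n; 0∣⇒≡0)
open import Data.Nat.DivMod using (_%_; _/_; m≡m%n+[m/n]*n; m%n<n)
open import Data.Nat.GCD using (gcd; gcd-GCD; gcd[m,n]∣m; gcd[m,n]∣n; module Bézout)
open import Data.Nat.Tactic.RingSolver using (solve-∀)
open import Data.Integer as ℤ using (ℤ; +_; -[1+_]; ∣_∣)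
import Data.Integer.Properties as ℤ
import Data.Integer.Divisibility as ℤ
open import Data.List using (List; []; _∷_; upTo)
open import Data.Nat.ListAction using (sum)
open import Data.List.Relation.Unary.All as All using (All; []; _∷_)
open import Data.List.Membership.Propositional using (_∈_)
open import Data.List.Membership.Propositional.Properties using (∈-upTo⁺)
open import Data.Product using (∃-syntax; _×_; _,_; proj₁; proj₂)
open import Data.Empty using (⊥-elim)
open import Relation.Nullary using (¬_; yes; no)
open import Relation.Binary.PropositionalEquality

open Bézout using (identity; +-; -+)

record Submonoid (S : ℕ → Set) : Set where
  field
    0∈ : S 0
    +-closed : ∀ {m n} → S m → S n → S (m + n)

  *-closed : ∀ k {n} → S n → S (k * n)
  *-closed zero    _  = 0∈
  *-closed (suc k) Sn = +-closed Sn (*-closed k Sn)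

  -- t = w² + j + s (w + 1) with j ≤ w, written as j (w + 1) + (w ∸ j) w + s (w + 1).
  consecutive⇒≥-square : ∀ {w} → S w → S (suc w) → ∀ {t} → w * w ≤ t → S t
  consecutive⇒≥-square {w} Sw S1+w {t} w²≤t =
    subst S decomposition
      (+-closed (+-closed (*-closed j S1+w) (*-closed (w ∸ j) Sw)) (*-closed s S1+w))
    where
    u j s : ℕ
    u = t ∸ w * w
    j = u % suc w
    s = u / suc w

    regroup : ∀ {w} j k s → k + j ≡ w →
      j * suc w + k * w + s * suc w ≡ w * w + (j + s * suc w)
    regroup j k s refl = ring j k s
      where
      ring : ∀ j k s → j * suc (k + j) + k * (k + j) + s * suc (k + j)
                     ≡ (k + j) * (k + j) + (j + s * suc (k + j))
      ring = solve-∀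

    decomposition : j * suc w + (w ∸ j) * w + s * suc w ≡ t
    decomposition = begin
      j * suc w + (w ∸ j) * w + s * suc w
        ≡⟨ regroup j (w ∸ j) s (m∸n+n≡m (s≤s⁻¹ (m%n<n u (suc w)))) ⟩
      w * w + (j + s * suc w) ≡⟨ cong (_+_ (w * w)) (sym (m≡m%n+[m/n]*n u (suc w))) ⟩
      w * w + u               ≡⟨ m+[n∸m]≡n w²≤t ⟩
      t                       ∎
      where open ≡-Reasoning

scaled : ∀ {S} → Submonoid S → ∀ r → Submonoid (λ t → S (t * r))
scaled {S} sub r = record
  { 0∈ = 0∈
  ; +-closed = λ {m} {n} Smr Snr → subst S (sym (*-distribʳ-+ r m n)) (+-closed Smr Snr)
  }
  where open Submonoid sub

data NonNegComb : List ℕ → ℕ → Set where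
  []  : NonNegComb [] 0
  _∷_ : ∀ {b bs c} m → NonNegComb bs c → NonNegComb (b ∷ bs) (m * b + c)

nonNegComb-submonoid : ∀ B → Submonoid (NonNegComb B)
nonNegComb-submonoid B = record { 0∈ = zero-comb B ; +-closed = plus }
  where
  zero-comb : ∀ B → NonNegComb B 0
  zero-comb []       = []
  zero-comb (_ ∷ bs) = 0 ∷ zero-comb bs

  regroup : ∀ m n b c d → (m + n) * b + (c + d) ≡ (m * b + c) + (n * b + d)
  regroup = solve-∀

  plus : ∀ {B x y} → NonNegComb B x → NonNegComb B y → NonNegComb B (x + y)
  plus []      []      = []
  plus {b ∷ _} (m ∷ p) (n ∷ q) = subst (NonNegComb _) (regroup m n b _ _) ((m + n) ∷ plus p q)

nonNegComb⇒posComb : ∀ {B c} → NonNegComb B c → PosComb B (sum B + c)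
nonNegComb⇒posComb []                 = []
nonNegComb⇒posComb {b ∷ bs} (m ∷ p) =
  subst (PosComb _) (regroup m b (sum bs) _) (_∷_ (suc m) (s≤s z≤n) (nonNegComb⇒posComb p))
  where
  regroup : ∀ m b s c → suc m * b + (s + c) ≡ b + s + (m * b + c)
  regroup = solve-∀

∣nonNegComb : ∀ {d B c} → All (d ∣_) B → NonNegComb B c → d ∣ c
∣nonNegComb []          []      = divides 0 refl
∣nonNegComb (d∣b ∷ d∣B) (m ∷ p) = ∣m∣n⇒∣m+n (∣-trans d∣b (n∣m*n m)) (∣nonNegComb d∣B p)

gcdList∣ : ∀ B → All (gcdList B ∣_) B
gcdList∣ []       = []
gcdList∣ (b ∷ bs) =
  gcd[m,n]∣m b (gcdList bs) ∷ All.map (∣-trans (gcd[m,n]∣n b (gcdList bs))) (gcdList∣ bs)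

bézout : ∀ B → ∃[ x ] NonNegComb B x × NonNegComb B (x + gcdList B)
bézout []       = 0 , [] , []
bézout (b ∷ bs) with bézout bs | identity (gcd-GCD b (gcdList bs))
... | x , p , q | +- u v eq =
  v * (x + g) , 0 ∷ *-closed v q , subst (NonNegComb _) (sym shifted) (u ∷ *-closed v p)
  where
  open Submonoid (nonNegComb-submonoid bs)
  g d : ℕ
  g = gcdList bs
  d = gcd b g
  shifted : v * (x + g) + d ≡ u * b + v * x
  shifted = begin
    v * (x + g) + d   ≡⟨ cong (_+ d) (*-distribˡ-+ v x g) ⟩
    v * x + v * g + d ≡⟨ +-assoc (v * x) (v * g) d ⟩
    v * x + (v * g + d) ≡⟨ cong (_+_ (v * x)) (trans (+-comm (v * g) d) eq) ⟩
    v * x + u * b     ≡⟨ +-comm (v * x) (u * b) ⟩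
    u * b + v * x     ∎
    where open ≡-Reasoning
... | x , p , q | -+ u v eq =
  u * b + v * x , u ∷ *-closed v p , subst (NonNegComb _) shifted (0 ∷ *-closed v q)
  where
  open Submonoid (nonNegComb-submonoid bs)
  g d : ℕ
  g = gcdList bs
  d = gcd b g
  shifted : v * (x + g) ≡ u * b + v * x + d
  shifted = begin
    v * (x + g)         ≡⟨ *-distribˡ-+ v x g ⟩
    v * x + v * g       ≡⟨ cong (_+_ (v * x)) (sym eq) ⟩
    v * x + (d + u * b) ≡⟨ cong (_+_ (v * x)) (+-comm d (u * b)) ⟩
    v * x + (u * b + d) ≡⟨ sym (+-assoc (v * x) (u * b) d) ⟩
    v * x + u * b + d   ≡⟨ cong (_+ d) (+-comm (v * x) (u * b)) ⟩
    u * b + v * x + d   ∎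
    where open ≡-Reasoning

large-multiples-nonNegComb : ∀ B → ∃[ K ] ∀ {t} → K ≤ t → NonNegComb B (t * gcdList B)
large-multiples-nonNegComb B with bézout B
... | x , Sx , Sx+r with ∣nonNegComb (gcdList∣ B) Sx
...   | divides w x≡wr =
  w * w , consecutive⇒≥-square {w} (subst S x≡wr Sx) (subst S x+r≡[1+w]r Sx+r)
  where
  r : ℕ
  r = gcdList B
  S : ℕ → Set
  S = NonNegComb B
  open Submonoid (scaled (nonNegComb-submonoid B) r)
  x+r≡[1+w]r : x + r ≡ suc w * r
  x+r≡[1+w]r = trans (cong (_+ r) x≡wr) (+-comm (w * r) r)

∣sum : ∀ {d B} → All (d ∣_) B → d ∣ sum B
∣sum []          = divides 0 refl
∣sum (d∣b ∷ d∣B) = ∣m∣n⇒∣m+n d∣b (∣sum d∣B)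

large-multiples-posComb : ∀ B → 0 < gcdList B →
  ∃[ K ] ∀ {c} → gcdList B ∣ c → K ≤ c → PosComb B c
large-multiples-posComb B 0<r with large-multiples-nonNegComb B
... | K , nonNeg = sum B + K * r , posComb
  where
  r : ℕ
  r = gcdList B
  instance
    r≢0 : NonZero r
    r≢0 = >-nonZero 0<r

  posComb : ∀ {c} → r ∣ c → sum B + K * r ≤ c → PosComb B c
  posComb {c} r∣c bound = subst (PosComb B) Σ+[c∸Σ]≡c (nonNegComb⇒posComb rest)
    where
    Σ+[c∸Σ]≡c : sum B + (c ∸ sum B) ≡ c
    Σ+[c∸Σ]≡c = m+[n∸m]≡n (≤-trans (m≤m+n (sum B) (K * r)) bound)

    rest : NonNegComb B (c ∸ sum B)
    rest with ∣m+n∣m⇒∣n (subst (r ∣_) (sym Σ+[c∸Σ]≡c) r∣c) (∣sum (gcdList∣ B))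
    ... | divides t c∸Σ≡tr = subst (NonNegComb B) (sym c∸Σ≡tr) (nonNeg K≤t)
      where
      K≤t : K ≤ t
      K≤t = *-cancelʳ-≤ K t r
        (subst₂ _≤_ (m+n∸m≡n (sum B) (K * r)) c∸Σ≡tr (∸-monoˡ-≤ (sum B) bound))

difference-∣-≥ : ∀ {r K} (l : ℤ) → (+ r) ℤ.∣ l → ∀ {m} → r ∣ m → K + ∣ l ∣ ≤ m →
  ∃[ c ] + m ≡ l ℤ.+ + c × r ∣ c × K ≤ c
difference-∣-≥ {r} {K} (+ k) r∣k {m} r∣m bound =
  m ∸ k , cong +_ (sym k+[m∸k]≡m) , ∣m+n∣m⇒∣n (subst (r ∣_) (sym k+[m∸k]≡m) r∣m) r∣k ,
  subst (_≤ m ∸ k) (m+n∸n≡m K k) (∸-monoˡ-≤ k bound)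
  where
  k+[m∸k]≡m : k + (m ∸ k) ≡ m
  k+[m∸k]≡m = m+[n∸m]≡n (≤-trans (m≤n+m k K) bound)
difference-∣-≥ {K = K} -[1+ k ] r∣l {m} r∣m bound =
  m + suc k ,
  sym (trans (ℤ.⊖-≥ (m≤n+m (suc k) m)) (cong +_ (m+n∸n≡m m (suc k)))) ,
  ∣m∣n⇒∣m+n r∣m r∣l ,
  ≤-trans (m≤m+n K (suc k)) (≤-trans bound (m≤m+n m (suc k)))

∣-positive⇒positive : ∀ {d n} → d ∣ n → 0 < n → 0 < d
∣-positive⇒positive {zero}  0∣n 0<n = ⊥-elim (<⇒≢ 0<n (sym (0∣⇒≡0 0∣n)))
∣-positive⇒positive {suc d} _   _   = z<s

lemma7 : (A : Pred) (r : ℕ) → (∀ a → A a → 0 < a) → IsGcdOf A r →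
    WeakAddition A r → CofiniteIn-rZ+ A r
lemma7 A r pos (r∣A , _) (B , _ , _ , refl , l , r∣l , shift) =
  (λ a Aa → pos a Aa , r∣A a Aa) , upTo (K + ∣ l ∣) , below-bound
  where
  0<r : 0 < r
  0<r with shift (sum B + 0) (nonNegComb⇒posComb (Submonoid.0∈ (nonNegComb-submonoid B)))
  ... | n , _ , An = ∣-positive⇒positive (r∣A n An) (pos n An)

  K : ℕ
  K = proj₁ (large-multiples-posComb B 0<r)

  eventually : ∀ {c} → r ∣ c → K ≤ c → PosComb B c
  eventually = proj₂ (large-multiples-posComb B 0<r)

  below-bound : ∀ m → 0 < m → r ∣ m → ¬ A m → m ∈ upTo (K + ∣ l ∣)
  below-bound m _ r∣m ¬Am with m <? K + ∣ l ∣
  ... | yes m<bound = ∈-upTo⁺ m<bound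
  ... | no m≮bound with difference-∣-≥ l r∣l r∣m (≮⇒≥ m≮bound)
  ...   | c , m≡l+c , r∣c , K≤c with shift c (eventually r∣c K≤c)
  ...     | n , n≡l+c , An = ⊥-elim (¬Am (subst A (ℤ.+-injective (trans n≡l+c (sym m≡l+c))) An))
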